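{- For a positive integer $H$ let ${\mathcal M}_2(\mathbb{Z};H)$ be the set of $2\times 2$ integer matrices with all entries of absolute value at most $H$, and for a polynomial $f\in\mathbb{Z}[X]$ let $P_2(H;f)$ be the number of $A\in{\mathcal M}_2(\mathbb{Z};H)$ whose characteristic polynomial equals $f$. Then, uniformly over all polynomials $f\in\mathbb{Z}[X]$ of degree $2$, \[ P_2(H;f)\le H^{1+o(1)},\qquad H\to\infty. \] -}

module Defs where

open import Data.Nat as ℕ using (ℕ; suc)
open import Data.Integer as ℤ using (ℤ; +_; _-_; _*_; -_; _+_; 1ℤ; 0ℤ)
open import Data.List using (List; map; upTo; length; filter; concatMap)
open import Data.Product using (_×_; _,_)
open import Data.Product.Properties using (≡-dec)
open import Relation.Binary.PropositionalEquality using (_≡_; _≢_)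
open import Relation.Binary.Definitions using (DecidableEquality)

-- A 2×2 integer matrix [[a , b] , [c , d]] is the quadruple (a , b , c , d).
Mat2 : Set
Mat2 = ℤ × ℤ × ℤ × ℤ

-- A polynomial of degree ≤ 2 in ℤ[X]:  (c₀ , c₁ , c₂)  means  c₀ + c₁ X + c₂ X².
Poly : Set
Poly = ℤ × ℤ × ℤ

Deg2 : Poly → Set
Deg2 (c₀ , c₁ , c₂) = c₂ ≢ 0ℤ

-- Characteristic polynomial det(X I - A) = X² - (a + d) X + (a d - b c).
charPoly : Mat2 → Poly
charPoly (a , b , c , d) = (a * d - b * c , - (a + d) , 1ℤ)

_≟P_ : DecidableEquality Poly
_≟P_ = ≡-dec ℤ._≟_ (≡-dec ℤ._≟_ ℤ._≟_)

box : ℕ → List ℤ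
box H = map (λ i → + i - + H) (upTo (suc (H ℕ.+ H)))

M2 : ℕ → List Mat2
M2 H = concatMap (λ a → concatMap (λ b → concatMap (λ c → map (λ d → (a , b , c , d))
         (box H)) (box H)) (box H)) (box H)

P2 : ℕ → Poly → ℕ
P2 H f = length (filter (λ A → charPoly A ≟P f) (M2 H))

module Submission where

-- Once the trace t = −c₁ and the entry a are fixed, d = t − a is determined and
-- b c = a (t − a) − c₀ =: N. If N ≠ 0, then |N| ≤ H² and b is a divisor of |N| up to sign,
-- so there are at most 2 τ(|N|) pairs (b, c); N = 0 happens for at most two values of a,
-- each contributing at most 2 (2H + 1) pairs. Hence P₂(H; f) ≤ 18 H max_{M ≤ H²} τ(M).
-- Splitting n = p^e m prime by prime, τ(p^e m) ≤ (e + 1) τ(m) with (e + 1)^Q ≤ p^e once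
-- p ≥ 2^Q and (e + 1)^Q ≤ Q^Q p^e for the fewer than 2^Q smaller primes, so
-- τ(n)^Q ≤ (Q^Q)^(2^Q) n. Taking Q = 3q gives P₂(H; f)^(3q) ≤ C H^(3q + 2) ≤ H^(3(q + p))
-- as soon as H ≥ C.

open import Defs

module FiniteSums where

  open import Data.Nat
  open import Data.Nat.Properties
  open import Data.Product using (_×_; _,_; ∃-syntax)
  open import Algebra.Properties.CommutativeSemigroup +-commutativeSemigroup
    using () renaming (interchange to +-interchange)
  open import Data.Sum using (_⊎_; inj₁; inj₂)
  open import Function using (_∘_)
  open import Data.Empty using (⊥-elim)
  open import Relation.Nullary using (Dec; yes; no; ¬_)
  open import Relation.Nullary.Decidable using (_×-dec_)
  open import Relation.Binary.PropositionalEquality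

  ∑< : ℕ → (ℕ → ℕ) → ℕ
  ∑< zero    f = 0
  ∑< (suc n) f = ∑< n f + f n

  syntax ∑< n (λ i → e) = ∑[ i < n ] e

  𝟙 : {A : Set} → Dec A → ℕ
  𝟙 (yes _) = 1
  𝟙 (no _)  = 0

  𝟙-yes : {A : Set} (a? : Dec A) → A → 𝟙 a? ≡ 1
  𝟙-yes (yes _) _ = refl
  𝟙-yes (no ¬a) a = ⊥-elim (¬a a)

  𝟙-no : {A : Set} (a? : Dec A) → ¬ A → 𝟙 a? ≡ 0
  𝟙-no (yes a) ¬a = ⊥-elim (¬a a)
  𝟙-no (no _)  _  = refl

  𝟙-mono : {A B : Set} (a? : Dec A) (b? : Dec B) → (A → B) → 𝟙 a? ≤ 𝟙 b?
  𝟙-mono (yes a) (yes _) _   = ≤-refl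
  𝟙-mono (yes a) (no ¬b) a→b = ⊥-elim (¬b (a→b a))
  𝟙-mono (no _)  _       _   = z≤n

  𝟙-mono-⊎ : {A B C : Set} (a? : Dec A) (b? : Dec B) (c? : Dec C) →
    (A → B ⊎ C) → 𝟙 a? ≤ 𝟙 b? + 𝟙 c?
  𝟙-mono-⊎ (no _)  _  _  _ = z≤n
  𝟙-mono-⊎ (yes a) b? c? f with f a
  ... | inj₁ b = ≤-trans (𝟙-mono (yes a) b? λ _ → b) (m≤m+n _ _)
  ... | inj₂ c = ≤-trans (𝟙-mono (yes a) c? λ _ → c) (m≤n+m _ _)

  𝟙-× : {A B : Set} (a? : Dec A) (b? : Dec B) → 𝟙 (a? ×-dec b?) ≡ 𝟙 a? * 𝟙 b?
  𝟙-× (yes _) (yes _) = refl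
  𝟙-× (yes _) (no _)  = refl
  𝟙-× (no _)  (yes _) = refl
  𝟙-× (no _)  (no _)  = refl

  module _ {f g : ℕ → ℕ} where

    ∑-cong : ∀ n → (∀ i → i < n → f i ≡ g i) → ∑< n f ≡ ∑< n g
    ∑-cong zero    _  = refl
    ∑-cong (suc n) eq = cong₂ _+_ (∑-cong n λ i i<n → eq i (m<n⇒m<1+n i<n)) (eq n ≤-refl)

    ∑-mono-≤ : ∀ n → (∀ i → i < n → f i ≤ g i) → ∑< n f ≤ ∑< n g
    ∑-mono-≤ zero    _  = z≤n
    ∑-mono-≤ (suc n) le = +-mono-≤ (∑-mono-≤ n λ i i<n → le i (m<n⇒m<1+n i<n)) (le n ≤-refl)

  ∑-const : ∀ n c → ∑[ _ < n ] c ≡ n * c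
  ∑-const zero    c = refl
  ∑-const (suc n) c = trans (cong (_+ c) (∑-const n c)) (+-comm (n * c) c)

  ∑-zero : ∀ n {f : ℕ → ℕ} → (∀ i → i < n → f i ≡ 0) → ∑< n f ≡ 0
  ∑-zero n eq = trans (∑-cong n eq) (trans (∑-const n 0) (*-zeroʳ n))

  ∑-distrib-+ : ∀ n (f g : ℕ → ℕ) → ∑[ i < n ] (f i + g i) ≡ ∑< n f + ∑< n g
  ∑-distrib-+ zero    f g = refl
  ∑-distrib-+ (suc n) f g =
    trans (cong (_+ (f n + g n)) (∑-distrib-+ n f g)) (+-interchange (∑< n f) (∑< n g) (f n) (g n))

  ∑-distribˡ-* : ∀ n c (f : ℕ → ℕ) → ∑[ i < n ] (c * f i) ≡ c * ∑< n f
  ∑-distribˡ-* zero    c f = sym (*-zeroʳ c)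
  ∑-distribˡ-* (suc n) c f =
    trans (cong (_+ c * f n) (∑-distribˡ-* n c f)) (sym (*-distribˡ-+ c (∑< n f) (f n)))

  ∑-distribʳ-* : ∀ n c (f : ℕ → ℕ) → ∑[ i < n ] (f i * c) ≡ ∑< n f * c
  ∑-distribʳ-* n c f =
    trans (∑-cong n λ i _ → *-comm (f i) c) (trans (∑-distribˡ-* n c f) (*-comm c (∑< n f)))

  ∑-comm : ∀ n m (f : ℕ → ℕ → ℕ) → ∑[ i < n ] ∑[ j < m ] f i j ≡ ∑[ j < m ] ∑[ i < n ] f i j
  ∑-comm zero    m f = sym (∑-zero m λ _ _ → refl)
  ∑-comm (suc n) m f = trans (cong (_+ ∑< m (f n)) (∑-comm n m f))
    (sym (∑-distrib-+ m (λ j → ∑[ i < n ] f i j) (f n)))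

  ∑-suc : ∀ n (f : ℕ → ℕ) → ∑< (suc n) f ≡ f 0 + ∑[ i < n ] f (suc i)
  ∑-suc zero    f = +-comm 0 (f 0)
  ∑-suc (suc n) f = trans (cong (_+ f (suc n)) (∑-suc n f)) (+-assoc (f 0) _ _)

  ∑-+ : ∀ a b (f : ℕ → ℕ) → ∑< (a + b) f ≡ ∑< a f + ∑[ i < b ] f (a + i)
  ∑-+ a zero    f = trans (cong (λ n → ∑< n f) (+-identityʳ a)) (sym (+-identityʳ _))
  ∑-+ a (suc b) f = trans (cong (λ n → ∑< n f) (+-suc a b))
    (trans (cong (_+ f (a + b)) (∑-+ a b f)) (+-assoc (∑< a f) _ _))

  ∑-reverse : ∀ n (g : ℕ → ℕ) → ∑[ i < n ] g (n ∸ i) ≡ ∑[ i < n ] g (suc i)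
  ∑-reverse zero    g = refl
  ∑-reverse (suc n) g = begin
    ∑[ i < suc n ] g (suc n ∸ i)          ≡⟨ ∑-suc n (λ i → g (suc n ∸ i)) ⟩
    g (suc n) + ∑[ i < n ] g (n ∸ i)      ≡⟨ cong (g (suc n) +_) (∑-reverse n g) ⟩
    g (suc n) + ∑[ i < n ] g (suc i)      ≡⟨ +-comm (g (suc n)) _ ⟩
    ∑[ i < suc n ] g (suc i)              ∎
    where open ≡-Reasoning

  term≤∑ : ∀ n (f : ℕ → ℕ) {i} → i < n → f i ≤ ∑< n f
  term≤∑ (suc n) f i<1+n with m<1+n⇒m<n∨m≡n i<1+n
  ... | inj₁ i<n  = ≤-trans (term≤∑ n f i<n) (m≤m+n _ _)
  ... | inj₂ refl = m≤n+m _ _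

  ∑-monoˡ-≤ : ∀ (f : ℕ → ℕ) {n m} → n ≤ m → ∑< n f ≤ ∑< m f
  ∑-monoˡ-≤ f {n} n≤m with m≤n⇒∃[o]m+o≡n n≤m
  ... | k , refl = ≤-trans (m≤m+n (∑< n f) _) (≤-reflexive (sym (∑-+ n k f)))

  module _ {P : ℕ → Set} (P? : ∀ i → Dec (P i)) where

    ∑𝟙≤1 : ∀ n → (∀ {i j} → i < n → j < n → P i → P j → i ≡ j) → ∑[ i < n ] 𝟙 (P? i) ≤ 1
    ∑𝟙≤1 zero    _   = z≤n
    ∑𝟙≤1 (suc n) uniq with P? n
    ... | no _   = ≤-trans (≤-reflexive (+-identityʳ _)) (∑𝟙≤1 n uniq′)
      where
      uniq′ : ∀ {i j} → i < n → j < n → P i → P j → i ≡ j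
      uniq′ i<n j<n = uniq (m<n⇒m<1+n i<n) (m<n⇒m<1+n j<n)
    ... | yes pn = ≤-reflexive (cong (_+ 1) (∑-zero n λ i i<n →
      𝟙-no (P? i) λ pi → <-irrefl (uniq (m<n⇒m<1+n i<n) ≤-refl pi pn) i<n))

    ∑𝟙≤𝟙 : ∀ n {Q : Set} (Q? : Dec Q) → (∀ {i} → P i → Q) →
      (∀ {i j} → i < n → j < n → P i → P j → i ≡ j) → ∑[ i < n ] 𝟙 (P? i) ≤ 𝟙 Q?
    ∑𝟙≤𝟙 n (yes _) _   uniq = ∑𝟙≤1 n uniq
    ∑𝟙≤𝟙 n (no ¬q) P⇒Q _    = ≤-reflexive (∑-zero n λ i _ → 𝟙-no (P? i) (¬q ∘ P⇒Q))

    ∑𝟙≤2 : ∀ n → (∀ {i j k} → i < n → j < n → k < n → P i → P j → P k → i ≡ j ⊎ i ≡ k ⊎ j ≡ k) →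
      ∑[ i < n ] 𝟙 (P? i) ≤ 2
    ∑𝟙≤2 zero    _ = z≤n
    ∑𝟙≤2 (suc n) three with P? n
    ... | no _   = ≤-trans (≤-reflexive (+-identityʳ _)) (∑𝟙≤2 n three′)
      where
      three′ : ∀ {i j k} → i < n → j < n → k < n → P i → P j → P k → i ≡ j ⊎ i ≡ k ⊎ j ≡ k
      three′ i<n j<n k<n = three (m<n⇒m<1+n i<n) (m<n⇒m<1+n j<n) (m<n⇒m<1+n k<n)
    ... | yes pn = +-monoˡ-≤ 1 (∑𝟙≤1 n uniq′)
      where
      uniq′ : ∀ {i j} → i < n → j < n → P i → P j → i ≡ j
      uniq′ i<n j<n pi pj with three (m<n⇒m<1+n i<n) (m<n⇒m<1+n j<n) ≤-refl pi pj pn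
      ... | inj₁ i≡j         = i≡j
      ... | inj₂ (inj₁ refl) = ⊥-elim (<-irrefl refl i<n)
      ... | inj₂ (inj₂ refl) = ⊥-elim (<-irrefl refl j<n)

  module _ {P : ℕ → Set} (P? : ∀ i → Dec (P i)) {Q : ℕ → ℕ → Set} (Q? : ∀ a b → Dec (Q a b)) where

    ∑𝟙≤∑∑𝟙-image : ∀ n m₁ m₂ (g : ℕ → ℕ → ℕ) →
      (∀ {i} → i < n → P i → ∃[ a ] ∃[ b ] (a < m₁ × b < m₂ × Q a b × g a b ≡ i)) →
      ∑[ i < n ] 𝟙 (P? i) ≤ ∑[ a < m₁ ] ∑[ b < m₂ ] 𝟙 (Q? a b)
    ∑𝟙≤∑∑𝟙-image n m₁ m₂ g preimage = begin
      ∑[ i < n ] 𝟙 (P? i)                                ≤⟨ ∑-mono-≤ n (λ i i<n → covered i i<n (P? i)) ⟩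
      ∑[ i < n ] ∑[ a < m₁ ] ∑[ b < m₂ ] hit a b i        ≡⟨ ∑-comm n m₁ _ ⟩
      ∑[ a < m₁ ] ∑[ i < n ] ∑[ b < m₂ ] hit a b i        ≡⟨ ∑-cong m₁ (λ a _ → ∑-comm n m₂ _) ⟩
      ∑[ a < m₁ ] ∑[ b < m₂ ] ∑[ i < n ] hit a b i        ≤⟨ ∑-mono-≤ m₁ (λ a _ → ∑-mono-≤ m₂ λ b _ → fibre≤1 a b) ⟩
      ∑[ a < m₁ ] ∑[ b < m₂ ] 𝟙 (Q? a b)                  ∎
      where
      open ≤-Reasoning
      hit : ℕ → ℕ → ℕ → ℕ
      hit a b i = 𝟙 (Q? a b) * 𝟙 (g a b ≟ i)

      fibre≤1 : ∀ a b → ∑[ i < n ] hit a b i ≤ 𝟙 (Q? a b)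
      fibre≤1 a b = begin
        ∑[ i < n ] hit a b i          ≡⟨ ∑-distribˡ-* n (𝟙 (Q? a b)) _ ⟩
        𝟙 (Q? a b) * ∑[ i < n ] 𝟙 (g a b ≟ i)
          ≤⟨ *-monoʳ-≤ (𝟙 (Q? a b)) (∑𝟙≤1 (g a b ≟_) n λ _ _ p q → trans (sym p) q) ⟩
        𝟙 (Q? a b) * 1                ≡⟨ *-identityʳ _ ⟩
        𝟙 (Q? a b)                    ∎

      covered : ∀ i → i < n → (p? : Dec (P i)) → 𝟙 p? ≤ ∑[ a < m₁ ] ∑[ b < m₂ ] hit a b i
      covered i i<n (no _)  = z≤n
      covered i i<n (yes p) with preimage i<n p
      ... | a , b , a<m₁ , b<m₂ , q , gab≡i = begin
        1                                      ≡⟨ cong₂ _*_ (𝟙-yes (Q? a b) q) (𝟙-yes (g a b ≟ i) gab≡i) ⟨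
        hit a b i                              ≤⟨ term≤∑ m₂ (λ b → hit a b i) b<m₂ ⟩
        ∑[ b < m₂ ] hit a b i                  ≤⟨ term≤∑ m₁ (λ a → ∑[ b < m₂ ] hit a b i) a<m₁ ⟩
        ∑[ a < m₁ ] ∑[ b < m₂ ] hit a b i      ∎

module DivisorFunction where

  open FiniteSums
  open import Data.Nat
  open import Data.Nat.Properties
  open import Data.Nat.Divisibility
  open import Data.Nat.DivMod using (m≡m%n+[m/n]*n; m%n<n)
  open import Data.Nat.Coprimality using (Coprime; coprime-divisor)
  open import Data.Nat.Primality
  open import Data.Nat.Induction using (<-wellFounded)
  open import Data.Nat.Tactic.RingSolver using (solve-∀)
  open import Induction.WellFounded using (Acc; acc)
  open import Data.Product using (_×_; _,_; ∃-syntax)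
  open import Data.Sum using (inj₁; inj₂)
  open import Data.Empty using (⊥-elim)
  open import Relation.Nullary using (yes; no)
  open import Relation.Binary.PropositionalEquality

  τ≤ : ℕ → ℕ → ℕ
  τ≤ L m = ∑[ j < L ] 𝟙 (suc j ∣? m)

  τ : ℕ → ℕ
  τ m = τ≤ m m

  τ≤≤τ : ∀ L m .{{_ : NonZero m}} → τ≤ L m ≤ τ m
  τ≤≤τ L m with ≤-total L m
  ... | inj₁ L≤m = ∑-monoˡ-≤ _ L≤m
  ... | inj₂ m≤L with m≤n⇒∃[o]m+o≡n m≤L
  ... | k , refl = ≤-reflexive (begin
    τ≤ (m + k) m                                      ≡⟨ ∑-+ m k _ ⟩
    τ m + ∑[ i < k ] 𝟙 (suc (m + i) ∣? m)             ≡⟨ cong (τ m +_) (∑-zero k λ i _ → 𝟙-no (suc (m + i) ∣? m) (too-big i)) ⟩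
    τ m + 0                                           ≡⟨ +-identityʳ (τ m) ⟩
    τ m                                               ∎)
    where
    open ≡-Reasoning
    too-big : ∀ i → suc (m + i) ∤ m
    too-big i d∣m = <⇒≱ (s≤s (m≤m+n m i)) (∣⇒≤ d∣m)

  ∣p^e*m⇒≡p^j*d : ∀ {p} → Prime p → ∀ e {m d} → d ∣ p ^ e * m →
    ∃[ j ] ∃[ d′ ] (j ≤ e × d′ ∣ m × d ≡ p ^ j * d′)
  ∣p^e*m⇒≡p^j*d pr zero {m} {d} d∣m =
    0 , d , z≤n , subst (d ∣_) (*-identityˡ m) d∣m , sym (*-identityˡ d)
  ∣p^e*m⇒≡p^j*d {p} pr (suc e) {m} {d} d∣p^[1+e]*m with p ∣? d
  ... | yes (divides q refl) with ∣p^e*m⇒≡p^j*d pr e {m} {q} (*-cancelʳ-∣ p {{prime⇒nonZero pr}} q*p∣p^e*m*p)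
    where
    q*p∣p^e*m*p : q * p ∣ p ^ e * m * p
    q*p∣p^e*m*p = subst (q * p ∣_) (rearrange p (p ^ e) m) d∣p^[1+e]*m
      where
      rearrange : ∀ x y z → x * y * z ≡ y * z * x
      rearrange = solve-∀
  ... | j , d′ , j≤e , d′∣m , refl = suc j , d′ , s≤s j≤e , d′∣m , rearrange (p ^ j) d′ p
    where
    rearrange : ∀ x y z → x * y * z ≡ z * x * y
    rearrange = solve-∀
  ∣p^e*m⇒≡p^j*d {p} pr (suc e) {m} {d} d∣p^[1+e]*m | no p∤d
    with ∣p^e*m⇒≡p^j*d pr e {m} {d} (coprime-divisor d⊥p (subst (d ∣_) (*-assoc p (p ^ e) m) d∣p^[1+e]*m))
    where
    d⊥p : Coprime d p
    d⊥p (i∣d , i∣p) with prime⇒irreducible pr i∣p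
    ... | inj₁ i≡1 = i≡1
    ... | inj₂ refl = ⊥-elim (p∤d i∣d)
  ... | j , d′ , j≤e , d′∣m , d≡ = j , d′ , m≤n⇒m≤1+n j≤e , d′∣m , d≡

  τ[p^e*m]≤[1+e]*τ[m] : ∀ {p} → Prime p → ∀ e m .{{_ : NonZero m}} → τ (p ^ e * m) ≤ suc e * τ m
  τ[p^e*m]≤[1+e]*τ[m] {p} pr e m = begin
    τ (p ^ e * m)                                  ≤⟨ ∑𝟙≤∑∑𝟙-image (λ i → suc i ∣? p ^ e * m) (λ _ b → suc b ∣? m)
                                                        (p ^ e * m) (suc e) m (λ j b → pred (p ^ j * suc b)) preimage ⟩
    ∑[ j < suc e ] τ m                             ≡⟨ ∑-const (suc e) (τ m) ⟩
    suc e * τ m                                    ∎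
    where
    open ≤-Reasoning
    preimage : ∀ {i} → i < p ^ e * m → suc i ∣ p ^ e * m →
      ∃[ j ] ∃[ b ] (j < suc e × b < m × suc b ∣ m × pred (p ^ j * suc b) ≡ i)
    preimage _ d∣ with ∣p^e*m⇒≡p^j*d pr e d∣
    ... | j , suc b , j≤e , 1+b∣m , 1+i≡ = j , b , s≤s j≤e , ∣⇒≤ 1+b∣m , 1+b∣m , cong pred (sym 1+i≡)
    ... | j , zero  , _   , _     , 1+i≡ = ⊥-elim (0≢1+n (trans (sym (*-zeroʳ (p ^ j))) (sym 1+i≡)))

  ∃[e,m]n≡k^e*m×k∤m : ∀ k n .{{_ : NonTrivial k}} .{{_ : NonZero n}} → ∃[ e ] ∃[ m ] (n ≡ k ^ e * m × k ∤ m)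
  ∃[e,m]n≡k^e*m×k∤m k n = go n (<-wellFounded n)
    where
    go : ∀ n .{{_ : NonZero n}} → Acc _<_ n → ∃[ e ] ∃[ m ] (n ≡ k ^ e * m × k ∤ m)
    go n (acc smaller) with k ∣? n
    ... | no k∤n = 0 , n , sym (*-identityˡ n) , k∤n
    ... | yes k∣n@(divides q refl) with go q {{quotient≢0 k∣n}} (smaller (quotient-< k∣n))
    ... | e , m , refl , k∤m = suc e , m , rearrange (k ^ e) m k , k∤m
      where
      rearrange : ∀ x y z → x * y * z ≡ z * x * y
      rearrange = solve-∀

  ^-distribʳ-* : ∀ m n o → (m * n) ^ o ≡ m ^ o * n ^ o
  ^-distribʳ-* m n zero    = refl
  ^-distribʳ-* m n (suc o) = trans (cong (m * n *_) (^-distribʳ-* m n o)) (interchange m n (m ^ o) (n ^ o))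
    where
    interchange : ∀ a b x y → a * b * (x * y) ≡ (a * x) * (b * y)
    interchange = solve-∀

  1+n≤2^n : ∀ n → suc n ≤ 2 ^ n
  1+n≤2^n zero    = ≤-refl
  1+n≤2^n (suc n) = ≤-trans 2+n≤2*[1+n] (*-monoʳ-≤ 2 (1+n≤2^n n))
    where
    2+n≤2*[1+n] : 2 + n ≤ 2 * suc n
    2+n≤2*[1+n] = s≤s (subst (suc n ≤_) (cong (λ x → n + suc x) (sym (+-identityʳ n))) (m≤n+m (suc n) n))

  module DivisorBound (Q : ℕ) .{{_ : NonZero Q}} where

    c B : ℕ
    c = Q ^ Q
    B = 2 ^ Q

    [1+e]^Q≤c*2^e : ∀ e → suc e ^ Q ≤ c * 2 ^ e
    [1+e]^Q≤c*2^e e = begin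
      suc e ^ Q              ≤⟨ ^-monoˡ-≤ Q 1+e≤Q*[1+u] ⟩
      (Q * suc u) ^ Q        ≡⟨ ^-distribʳ-* Q (suc u) Q ⟩
      c * suc u ^ Q          ≤⟨ *-monoʳ-≤ c (^-monoˡ-≤ Q (1+n≤2^n u)) ⟩
      c * (2 ^ u) ^ Q        ≡⟨ cong (c *_) (^-*-assoc 2 u Q) ⟩
      c * 2 ^ (u * Q)        ≤⟨ *-monoʳ-≤ c (^-monoʳ-≤ 2 u*Q≤e) ⟩
      c * 2 ^ e              ∎
      where
      open ≤-Reasoning
      u = e / Q
      e≡ : e ≡ e % Q + u * Q
      e≡ = m≡m%n+[m/n]*n e Q
      u*Q≤e : u * Q ≤ e
      u*Q≤e = subst (u * Q ≤_) (sym e≡) (m≤n+m (u * Q) (e % Q))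
      1+e≤Q*[1+u] : suc e ≤ Q * suc u
      1+e≤Q*[1+u] = subst₂ _≤_ (cong suc (sym e≡)) (trans (cong (Q +_) (*-comm u Q)) (sym (*-suc Q u)))
        (+-monoˡ-≤ (u * Q) (m%n<n e Q))

    [1+e]^Q≤k^e : ∀ e {k} → B ≤ k → suc e ^ Q ≤ k ^ e
    [1+e]^Q≤k^e e {k} B≤k = begin
      suc e ^ Q        ≤⟨ ^-monoˡ-≤ Q (1+n≤2^n e) ⟩
      (2 ^ e) ^ Q      ≡⟨ ^-*-assoc 2 e Q ⟩
      2 ^ (e * Q)      ≡⟨ cong (2 ^_) (*-comm e Q) ⟩
      2 ^ (Q * e)      ≡⟨ ^-*-assoc 2 Q e ⟨
      B ^ e            ≤⟨ ^-monoˡ-≤ e B≤k ⟩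
      k ^ e            ∎
      where open ≤-Reasoning

    [1+e]^Q*c^[B∸1+k]≤k^e*c^[B∸k] : ∀ e {k} → 2 ≤ k → suc e ^ Q * c ^ (B ∸ suc k) ≤ k ^ e * c ^ (B ∸ k)
    [1+e]^Q*c^[B∸1+k]≤k^e*c^[B∸k] e {k} 2≤k with k <? B
    ... | yes k<B rewrite +-∸-assoc 1 k<B = begin
      suc e ^ Q * c ^ x       ≤⟨ *-monoˡ-≤ (c ^ x) ([1+e]^Q≤c*2^e e) ⟩
      c * 2 ^ e * c ^ x       ≤⟨ *-monoˡ-≤ (c ^ x) (*-monoʳ-≤ c (^-monoˡ-≤ e 2≤k)) ⟩
      c * k ^ e * c ^ x       ≡⟨ rearrange c (k ^ e) (c ^ x) ⟩
      k ^ e * (c * c ^ x)     ∎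
      where
      open ≤-Reasoning
      x = B ∸ suc k
      rearrange : ∀ a b d → a * b * d ≡ b * (a * d)
      rearrange = solve-∀
    ... | no k≮B = begin
      suc e ^ Q * c ^ (B ∸ suc k)  ≡⟨ cong (λ x → suc e ^ Q * c ^ x) (m≤n⇒m∸n≡0 (m≤n⇒m≤1+n B≤k)) ⟩
      suc e ^ Q * 1                ≤⟨ *-monoˡ-≤ 1 ([1+e]^Q≤k^e e B≤k) ⟩
      k ^ e * 1                    ≡⟨ cong (λ x → k ^ e * c ^ x) (m≤n⇒m∸n≡0 B≤k) ⟨
      k ^ e * c ^ (B ∸ k)          ∎
      where
      open ≤-Reasoning
      B≤k = ≮⇒≥ k≮B

    -- k Rough n: all prime factors of n are ≥ k, and each prime in [k, B) may still cost a
    -- factor c, hence c ^ (B ∸ k). The fuel d (n < k + d) shrinks as k grows.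
    τ^Q≤c^[B∸k]*n : ∀ d k n .{{_ : NonZero n}} → n < k + d → 2 ≤ k → k Rough n → τ n ^ Q ≤ c ^ (B ∸ k) * n
    τ^Q≤c^[B∸k]*n zero k 1 _ _ _ = begin
      τ 1 ^ Q             ≡⟨ ^-zeroˡ Q ⟩
      1                   ≤⟨ m^n>0 c {{m^n≢0 Q Q}} (B ∸ k) ⟩
      c ^ (B ∸ k)         ≡⟨ *-identityʳ _ ⟨
      c ^ (B ∸ k) * 1     ∎
      where open ≤-Reasoning
    τ^Q≤c^[B∸k]*n zero k n@(suc (suc _)) n<k+0 _ rough =
      ⊥-elim (<⇒≱ (subst (n <_) (+-identityʳ k) n<k+0) (rough⇒≤ rough))
    τ^Q≤c^[B∸k]*n (suc d) k n n<k+1+d 2≤k rough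
      with ∃[e,m]n≡k^e*m×k∤m k n {{n>1⇒nonTrivial 2≤k}}
    ... | e , m , refl , k∤m = begin
      τ (k ^ e * m) ^ Q                    ≤⟨ ^-monoˡ-≤ Q (τ[k^e*m]≤[1+e]*τ[m] e rough) ⟩
      (suc e * τ m) ^ Q                    ≡⟨ ^-distribʳ-* (suc e) (τ m) Q ⟩
      suc e ^ Q * τ m ^ Q                  ≤⟨ *-monoʳ-≤ (suc e ^ Q) ih ⟩
      suc e ^ Q * (c ^ (B ∸ suc k) * m)    ≡⟨ *-assoc (suc e ^ Q) _ m ⟨
      suc e ^ Q * c ^ (B ∸ suc k) * m      ≤⟨ *-monoˡ-≤ m ([1+e]^Q*c^[B∸1+k]≤k^e*c^[B∸k] e 2≤k) ⟩
      k ^ e * c ^ (B ∸ k) * m              ≡⟨ rearrange (k ^ e) (c ^ (B ∸ k)) m ⟩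
      c ^ (B ∸ k) * (k ^ e * m)            ∎
      where
      open ≤-Reasoning
      instance
        _ : NonZero m
        _ = m*n≢0⇒n≢0 (k ^ e)
      m∣n : m ∣ k ^ e * m
      m∣n = n∣m*n (k ^ e)
      m<1+k+d : m < suc k + d
      m<1+k+d = ≤-trans (s≤s (∣⇒≤ m∣n)) (≤-trans n<k+1+d (≤-reflexive (+-suc k d)))
      ih : τ m ^ Q ≤ c ^ (B ∸ suc k) * m
      ih = τ^Q≤c^[B∸k]*n d (suc k) m m<1+k+d (m≤n⇒m≤1+n 2≤k) (∤⇒rough-suc k∤m (rough∧∣⇒rough rough m∣n))
      τ[k^e*m]≤[1+e]*τ[m] : ∀ e → k Rough (k ^ e * m) → τ (k ^ e * m) ≤ suc e * τ m
      τ[k^e*m]≤[1+e]*τ[m] zero    _     = ≤-trans (≤-reflexive (cong τ (*-identityˡ m))) (m≤m+n (τ m) 0)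
      τ[k^e*m]≤[1+e]*τ[m] (suc e) rough = τ[p^e*m]≤[1+e]*τ[m] k-prime (suc e) m
        where
        k-prime : Prime k
        k-prime = rough∧∣⇒prime {{n>1⇒nonTrivial 2≤k}} rough (∣m⇒∣m*n m (m∣m*n (k ^ e)))
      rearrange : ∀ x y z → x * y * z ≡ y * (x * z)
      rearrange = solve-∀

  τ^Q≤[Q^Q]^[2^Q∸2]*n : ∀ Q n .{{_ : NonZero Q}} .{{_ : NonZero n}} → τ n ^ Q ≤ (Q ^ Q) ^ (2 ^ Q ∸ 2) * n
  τ^Q≤[Q^Q]^[2^Q∸2]*n Q n = DivisorBound.τ^Q≤c^[B∸k]*n Q n 2 n (n≤1+n (suc n)) ≤-refl 2-rough

module MatrixCount where

  open FiniteSums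
  open DivisorFunction using (τ≤; τ; τ≤≤τ)
  open import Data.Nat as ℕ using (ℕ; zero; suc; z≤n)
  import Data.Nat.Properties as ℕ
  open import Data.Nat.Divisibility using (divides; _∣?_; 0∣⇒≡0) renaming (_∣_ to _∣ℕ_)
  open import Data.Nat.ListAction using (sum)
  open import Data.Nat.ListAction.Properties using (sum-++)
  open import Data.Integer as ℤ using (ℤ; +_; _-_; _*_; -_; _+_; 0ℤ; ∣_∣; _⊖_)
  import Data.Integer.Properties as ℤ
  open import Data.Integer.Tactic.RingSolver using (solve-∀)
  open import Data.List using (List; []; _∷_; _++_; map; concatMap; filter; length; applyUpTo; upTo)
  open import Data.List.Properties using (map-++; map-∘)
  open import Data.Product using (_×_; _,_; proj₁; proj₂)
  open import Data.Sum using (_⊎_; inj₁; inj₂)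
  open import Function using (_∘_)
  open import Relation.Nullary using (Dec; yes; no; ¬_)
  open import Relation.Nullary.Decidable using (_×-dec_)
  open import Relation.Unary using (Decidable)
  open import Relation.Binary.PropositionalEquality

  ∑ᴸ : {A : Set} → (A → ℕ) → List A → ℕ
  ∑ᴸ h xs = sum (map h xs)

  length-filter : {A : Set} {P : A → Set} (P? : Decidable P) (xs : List A) →
    length (filter P? xs) ≡ ∑ᴸ (𝟙 ∘ P?) xs
  length-filter P? []       = refl
  length-filter P? (x ∷ xs) with P? x
  ... | yes _ = cong suc (length-filter P? xs)
  ... | no _  = length-filter P? xs

  ∑ᴸ-concatMap : {A B : Set} (h : B → ℕ) (g : A → List B) (xs : List A) →
    ∑ᴸ h (concatMap g xs) ≡ ∑ᴸ (∑ᴸ h ∘ g) xs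
  ∑ᴸ-concatMap h g []       = refl
  ∑ᴸ-concatMap h g (x ∷ xs) = begin
    sum (map h (g x ++ concatMap g xs))       ≡⟨ cong sum (map-++ h (g x) _) ⟩
    sum (map h (g x) ++ map h (concatMap g xs)) ≡⟨ sum-++ (map h (g x)) _ ⟩
    ∑ᴸ h (g x) ℕ.+ ∑ᴸ h (concatMap g xs)                  ≡⟨ cong (∑ᴸ h (g x) ℕ.+_) (∑ᴸ-concatMap h g xs) ⟩
    ∑ᴸ h (g x) ℕ.+ ∑ᴸ (∑ᴸ h ∘ g) xs                       ∎
    where open ≡-Reasoning

  ∑ᴸ-applyUpTo : {A : Set} (h : A → ℕ) (g : ℕ → A) (n : ℕ) → ∑ᴸ h (applyUpTo g n) ≡ ∑[ i < n ] h (g i)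
  ∑ᴸ-applyUpTo h g zero    = refl
  ∑ᴸ-applyUpTo h g (suc n) =
    trans (cong (h (g 0) ℕ.+_) (∑ᴸ-applyUpTo h (g ∘ suc) n)) (sym (∑-suc n (h ∘ g)))

  boxSize : ℕ → ℕ
  boxSize H = suc (H ℕ.+ H)

  entry : ℕ → ℕ → ℤ
  entry H i = + i - + H

  ∑ᴸ-box : ∀ H (h : ℤ → ℕ) → ∑ᴸ h (box H) ≡ ∑[ i < boxSize H ] h (entry H i)
  ∑ᴸ-box H h = trans (cong sum (sym (map-∘ (upTo (boxSize H))))) (∑ᴸ-applyUpTo (h ∘ entry H) (λ i → i) (boxSize H))

  entry-injective : ∀ H {i j} → entry H i ≡ entry H j → i ≡ j
  entry-injective H {i} {j} eq = ℤ.+-injective (begin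
    + i                 ≡⟨ i≡[i-H]+H (+ i) (+ H) ⟩
    entry H i + + H     ≡⟨ cong (_+ + H) eq ⟩
    entry H j + + H     ≡⟨ i≡[i-H]+H (+ j) (+ H) ⟨
    + j                 ∎)
    where
    open ≡-Reasoning
    i≡[i-H]+H : ∀ i H → i ≡ (i - H) + H
    i≡[i-H]+H = solve-∀

  ∣entry∣-below : ∀ H {i} → i ℕ.≤ H → ∣ entry H i ∣ ≡ H ℕ.∸ i
  ∣entry∣-below H {i} i≤H = trans (cong ∣_∣ (ℤ.m-n≡m⊖n i H)) (ℤ.∣⊖∣-≤ i≤H)

  ∣entry∣-above : ∀ H i → ∣ entry H (H ℕ.+ i) ∣ ≡ i
  ∣entry∣-above H i = begin
    ∣ entry H (H ℕ.+ i) ∣     ≡⟨ cong ∣_∣ (ℤ.m-n≡m⊖n (H ℕ.+ i) H) ⟩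
    ∣ (H ℕ.+ i) ⊖ H ∣         ≡⟨ ℤ.∣m⊖n∣≡∣n⊖m∣ (H ℕ.+ i) H ⟩
    ∣ H ⊖ (H ℕ.+ i) ∣         ≡⟨ ℤ.∣⊖∣-≤ (ℕ.m≤m+n H i) ⟩
    H ℕ.+ i ℕ.∸ H             ≡⟨ ℕ.m+n∸m≡n H i ⟩
    i                         ∎
    where open ≡-Reasoning

  ∣entry∣≤H : ∀ H {i} → i ℕ.< boxSize H → ∣ entry H i ∣ ℕ.≤ H
  ∣entry∣≤H H {i} i<size with ℕ.≤-total i H
  ... | inj₁ i≤H = subst (ℕ._≤ H) (sym (∣entry∣-below H i≤H)) (ℕ.m∸n≤m H i)
  ... | inj₂ H≤i with ℕ.m≤n⇒∃[o]m+o≡n H≤i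
  ... | j , refl = subst (ℕ._≤ H) (sym (∣entry∣-above H j)) (ℕ.+-cancelˡ-≤ H j H (ℕ.s≤s⁻¹ i<size))

  ∑-box-∣entry∣ : ∀ H (g : ℕ → ℕ) →
    ∑[ i < boxSize H ] g ∣ entry H i ∣ ≡ ∑[ j < H ] g (suc j) ℕ.+ (g 0 ℕ.+ ∑[ j < H ] g (suc j))
  ∑-box-∣entry∣ H g = begin
    ∑[ i < boxSize H ] g ∣ entry H i ∣
      ≡⟨ cong (λ n → ∑[ i < n ] g ∣ entry H i ∣) (sym (ℕ.+-suc H H)) ⟩
    ∑[ i < H ℕ.+ suc H ] g ∣ entry H i ∣
      ≡⟨ ∑-+ H (suc H) _ ⟩
    ∑[ i < H ] g ∣ entry H i ∣ ℕ.+ ∑[ i < suc H ] g ∣ entry H (H ℕ.+ i) ∣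
      ≡⟨ cong₂ ℕ._+_ (∑-cong H λ i i<H → cong g (∣entry∣-below H (ℕ.<⇒≤ i<H)))
                     (∑-cong (suc H) λ i _ → cong g (∣entry∣-above H i)) ⟩
    ∑[ i < H ] g (H ℕ.∸ i) ℕ.+ ∑[ i < suc H ] g i
      ≡⟨ cong₂ ℕ._+_ (∑-reverse H g) (∑-suc H g) ⟩
    ∑[ j < H ] g (suc j) ℕ.+ (g 0 ℕ.+ ∑[ j < H ] g (suc j))   ∎
    where open ≡-Reasoning

  ∑-box-𝟙≡ : ∀ H z → ∑[ i < boxSize H ] 𝟙 (entry H i ℤ.≟ z) ℕ.≤ 1
  ∑-box-𝟙≡ H z = ∑𝟙≤1 (λ i → entry H i ℤ.≟ z) (boxSize H) λ _ _ p q → entry-injective H (trans p (sym q))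

  ∑ᴸ-concatMap-box : {B : Set} (H : ℕ) (h : B → ℕ) (g : ℤ → List B) →
    ∑ᴸ h (concatMap g (box H)) ≡ ∑[ i < boxSize H ] ∑ᴸ h (g (entry H i))
  ∑ᴸ-concatMap-box H h g = trans (∑ᴸ-concatMap h g (box H)) (∑ᴸ-box H (∑ᴸ h ∘ g))

  ∑ᴸ-map-box : {B : Set} (H : ℕ) (h : B → ℕ) (g : ℤ → B) →
    ∑ᴸ h (map g (box H)) ≡ ∑[ i < boxSize H ] h (g (entry H i))
  ∑ᴸ-map-box H h g = trans (cong sum (sym (map-∘ (box H)))) (∑ᴸ-box H (h ∘ g))

  P2≡∑ : ∀ H f → let n = boxSize H; x = entry H in
    P2 H f ≡ ∑[ a < n ] ∑[ b < n ] ∑[ c < n ] ∑[ d < n ] 𝟙 (charPoly (x a , x b , x c , x d) ≟P f)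
  P2≡∑ H f =
    trans (length-filter has-f (M2 H)) (
    trans (∑ᴸ-concatMap-box H χ fix₁) (∑-cong n λ a _ →
    trans (∑ᴸ-concatMap-box H χ (fix₂ (x a))) (∑-cong n λ b _ →
    trans (∑ᴸ-concatMap-box H χ (fix₃ (x a) (x b))) (∑-cong n λ c _ →
    ∑ᴸ-map-box H χ (λ d → (x a , x b , x c , d))))))
    where
    n = boxSize H
    x = entry H
    fix₃ : ℤ → ℤ → ℤ → List Mat2
    fix₃ a b c = map (λ d → (a , b , c , d)) (box H)
    fix₂ : ℤ → ℤ → List Mat2
    fix₂ a b = concatMap (fix₃ a b) (box H)
    fix₁ : ℤ → List Mat2
    fix₁ a = concatMap (fix₂ a) (box H)
    has-f : Decidable (λ A → charPoly A ≡ f)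
    has-f A = charPoly A ≟P f
    χ : Mat2 → ℕ
    χ = 𝟙 ∘ has-f

  productCount : ℕ → ℤ → ℕ
  productCount H N = ∑[ b < boxSize H ] ∑[ c < boxSize H ] 𝟙 (entry H b * entry H c ℤ.≟ N)

  productCount-0 : ∀ H → productCount H 0ℤ ℕ.≤ boxSize H ℕ.+ boxSize H
  productCount-0 H = begin
    productCount H 0ℤ
      ≤⟨ ∑-mono-≤ n (λ b _ → ∑-mono-≤ n λ c _ → 𝟙-mono-⊎ (x b * x c ℤ.≟ 0ℤ) (x b ℤ.≟ 0ℤ) (x c ℤ.≟ 0ℤ)
                                                     (ℤ.i*j≡0⇒i≡0∨j≡0 (x b))) ⟩
    ∑[ b < n ] ∑[ c < n ] (zero? b ℕ.+ zero? c)
      ≡⟨ ∑-cong n (λ b _ → trans (∑-distrib-+ n (λ _ → zero? b) zero?) (cong (ℕ._+ zeros) (∑-const n (zero? b)))) ⟩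
    ∑[ b < n ] (n ℕ.* zero? b ℕ.+ zeros)
      ≡⟨ ∑-distrib-+ n (λ b → n ℕ.* zero? b) (λ _ → zeros) ⟩
    ∑[ b < n ] (n ℕ.* zero? b) ℕ.+ ∑[ _ < n ] zeros
      ≡⟨ cong₂ ℕ._+_ (∑-distribˡ-* n n zero?) (∑-const n zeros) ⟩
    n ℕ.* zeros ℕ.+ n ℕ.* zeros
      ≤⟨ ℕ.+-mono-≤ (ℕ.*-monoʳ-≤ n (∑-box-𝟙≡ H 0ℤ)) (ℕ.*-monoʳ-≤ n (∑-box-𝟙≡ H 0ℤ)) ⟩
    n ℕ.* 1 ℕ.+ n ℕ.* 1
      ≡⟨ cong₂ ℕ._+_ (ℕ.*-identityʳ n) (ℕ.*-identityʳ n) ⟩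
    n ℕ.+ n   ∎
    where
    open ℕ.≤-Reasoning
    n = boxSize H
    x = entry H
    zero? : ℕ → ℕ
    zero? i = 𝟙 (x i ℤ.≟ 0ℤ)
    zeros = ∑[ i < n ] zero? i

  productCount≡0 : ∀ H {N} → H ℕ.* H ℕ.< ∣ N ∣ → productCount H N ≡ 0
  productCount≡0 H {N} H²<∣N∣ = ∑-zero n λ b b<n → ∑-zero n λ c c<n →
    𝟙-no (x b * x c ℤ.≟ N) λ xb*xc≡N → ℕ.<⇒≱ H²<∣N∣ (begin
      ∣ N ∣                 ≡⟨ cong ∣_∣ xb*xc≡N ⟨
      ∣ x b * x c ∣         ≡⟨ ℤ.abs-* (x b) (x c) ⟩
      ∣ x b ∣ ℕ.* ∣ x c ∣   ≤⟨ ℕ.*-mono-≤ (∣entry∣≤H H b<n) (∣entry∣≤H H c<n) ⟩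
      H ℕ.* H               ∎)
    where
    open ℕ.≤-Reasoning
    n = boxSize H
    x = entry H

  productCount≤2τ≤ : ∀ H {N} → N ≢ 0ℤ → productCount H N ℕ.≤ τ≤ H ∣ N ∣ ℕ.+ τ≤ H ∣ N ∣
  productCount≤2τ≤ H {N} N≢0 = begin
    productCount H N                                        ≤⟨ ∑-mono-≤ n (λ b _ → row≤ b) ⟩
    ∑[ b < n ] divides? ∣ x b ∣                             ≡⟨ ∑-box-∣entry∣ H divides? ⟩
    τ≤ H M ℕ.+ (divides? 0 ℕ.+ τ≤ H M)                      ≡⟨ cong (λ k → τ≤ H M ℕ.+ (k ℕ.+ τ≤ H M)) (𝟙-no (0 ∣? M) 0∤M) ⟩
    τ≤ H M ℕ.+ τ≤ H M                                       ∎
    where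
    open ℕ.≤-Reasoning
    n = boxSize H
    x = entry H
    M = ∣ N ∣
    divides? : ℕ → ℕ
    divides? k = 𝟙 (k ∣? M)
    0∤M : ¬ (0 ∣ℕ M)
    0∤M 0∣M = N≢0 (ℤ.∣i∣≡0⇒i≡0 (0∣⇒≡0 0∣M))
    row≤ : ∀ b → ∑[ c < n ] 𝟙 (x b * x c ℤ.≟ N) ℕ.≤ divides? ∣ x b ∣
    row≤ b = ∑𝟙≤𝟙 (λ c → x b * x c ℤ.≟ N) n (∣ x b ∣ ∣? M) ∣xb∣∣M λ {i} {j} _ _ p q →
      entry-injective H (ℤ.*-cancelˡ-≡ (x b) (x i) (x j) {{xb≢0 p}} (trans p (sym q)))
      where
      xb≢0 : ∀ {c} → x b * x c ≡ N → ℤ.NonZero (x b)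
      xb≢0 {c} p = ℤ.≢-nonZero {x b} λ xb≡0 → N≢0 (trans (sym p) (trans (cong (_* x c) xb≡0) (ℤ.*-zeroˡ (x c))))
      ∣xb∣∣M : ∀ {c} → x b * x c ≡ N → ∣ x b ∣ ∣ℕ M
      ∣xb∣∣M {c} p = divides ∣ x c ∣ (trans (cong ∣_∣ (sym p)) (trans (ℤ.abs-* (x b) (x c)) (ℕ.*-comm ∣ x b ∣ ∣ x c ∣)))

  u*[t-u]≡v*[t-v]⇒u≡v⊎v≡t-u : ∀ t u v → u * (t - u) ≡ v * (t - v) → u ≡ v ⊎ v ≡ t - u
  u*[t-u]≡v*[t-v]⇒u≡v⊎v≡t-u t u v eq with ℤ.i*j≡0⇒i≡0∨j≡0 (u - v) factored
    where
    difference : ∀ t u v → u * (t - u) - v * (t - v) ≡ (u - v) * (t - u - v)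
    difference = solve-∀
    factored : (u - v) * (t - u - v) ≡ 0ℤ
    factored = trans (sym (difference t u v)) (trans (cong (_- v * (t - v)) eq) (ℤ.+-inverseʳ (v * (t - v))))
  ... | inj₁ u-v≡0   = inj₁ (ℤ.i-j≡0⇒i≡j u v u-v≡0)
  ... | inj₂ t-u-v≡0 = inj₂ (sym (ℤ.i-j≡0⇒i≡j (t - u) v t-u-v≡0))

  ∑-box-quadratic≤2 : ∀ H t c₀ → ∑[ a < boxSize H ] 𝟙 (entry H a * (t - entry H a) - c₀ ℤ.≟ 0ℤ) ℕ.≤ 2
  ∑-box-quadratic≤2 H t c₀ = ∑𝟙≤2 (λ a → x a * (t - x a) - c₀ ℤ.≟ 0ℤ) n at-most-two
    where
    n = boxSize H
    x = entry H
    Root : ℕ → Set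
    Root a = x a * (t - x a) - c₀ ≡ 0ℤ
    root : ∀ {a} → Root a → x a * (t - x a) ≡ c₀
    root {a} = ℤ.i-j≡0⇒i≡j (x a * (t - x a)) c₀
    same-or-conjugate : ∀ {i j} → Root i → Root j → i ≡ j ⊎ x j ≡ t - x i
    same-or-conjugate {i} {j} ri rj with u*[t-u]≡v*[t-v]⇒u≡v⊎v≡t-u t (x i) (x j) (trans (root ri) (sym (root rj)))
    ... | inj₁ xi≡xj = inj₁ (entry-injective H xi≡xj)
    ... | inj₂ xj≡t-xi = inj₂ xj≡t-xi
    at-most-two : ∀ {i j k} → i ℕ.< n → j ℕ.< n → k ℕ.< n → Root i → Root j → Root k → i ≡ j ⊎ i ≡ k ⊎ j ≡ k
    at-most-two _ _ _ ri rj rk with same-or-conjugate ri rj | same-or-conjugate ri rk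
    ... | inj₁ i≡j | _        = inj₁ i≡j
    ... | inj₂ _   | inj₁ i≡k = inj₂ (inj₁ i≡k)
    ... | inj₂ xj≡t-xi | inj₂ xk≡t-xi = inj₂ (inj₂ (entry-injective H (trans xj≡t-xi (sym xk≡t-xi))))

  charPoly≡⇒ : ∀ {a b c d c₀ c₁ c₂} → charPoly (a , b , c , d) ≡ (c₀ , c₁ , c₂) →
    d ≡ - c₁ - a × b * c ≡ a * (- c₁ - a) - c₀
  charPoly≡⇒ {a} {b} {c} {d} {c₀} {c₁} eq = d≡ , (begin
    b * c                      ≡⟨ b*c≡ a b c d ⟩
    a * d - (a * d - b * c)    ≡⟨ cong₂ (λ u v → a * u - v) d≡ (cong proj₁ eq) ⟩
    a * (- c₁ - a) - c₀        ∎)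
    where
    open ≡-Reasoning
    b*c≡ : ∀ a b c d → b * c ≡ a * d - (a * d - b * c)
    b*c≡ = solve-∀
    d≡[a+d]-a : ∀ a d → d ≡ - - (a + d) - a
    d≡[a+d]-a = solve-∀
    d≡ : d ≡ - c₁ - a
    d≡ = trans (d≡[a+d]-a a d) (cong (λ s → - s - a) (cong (proj₁ ∘ proj₂) eq))

  productCount≤ : ∀ H N W → (∀ M .{{_ : ℕ.NonZero M}} → M ℕ.≤ H ℕ.* H → τ M ℕ.≤ W) →
    productCount H N ℕ.≤ 𝟙 (N ℤ.≟ 0ℤ) ℕ.* (boxSize H ℕ.+ boxSize H) ℕ.+ (W ℕ.+ W)
  productCount≤ H N W τ≤W with N ℤ.≟ 0ℤ
  ... | yes refl = ℕ.≤-trans (productCount-0 H) (ℕ.≤-trans (ℕ.≤-reflexive (sym (ℕ.+-identityʳ _))) (ℕ.m≤m+n _ _))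
  ... | no N≢0 with ∣ N ∣ ℕ.≤? H ℕ.* H
  ...   | no  H²<∣N∣ = ℕ.≤-trans (ℕ.≤-reflexive (productCount≡0 H (ℕ.≰⇒> H²<∣N∣))) z≤n
  ...   | yes ∣N∣≤H² = ℕ.≤-trans (productCount≤2τ≤ H N≢0) (ℕ.+-mono-≤ τ≤H∣N∣≤W τ≤H∣N∣≤W)
    where
    instance
      _ : ℕ.NonZero ∣ N ∣
      _ = ℤ.≢-nonZero N≢0
    τ≤H∣N∣≤W : τ≤ H ∣ N ∣ ℕ.≤ W
    τ≤H∣N∣≤W = ℕ.≤-trans (τ≤≤τ H ∣ N ∣) (τ≤W ∣ N ∣ ∣N∣≤H²)

  P2≤ : ∀ H f W → (∀ M .{{_ : ℕ.NonZero M}} → M ℕ.≤ H ℕ.* H → τ M ℕ.≤ W) →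
    P2 H f ℕ.≤ 2 ℕ.* (boxSize H ℕ.+ boxSize H) ℕ.+ boxSize H ℕ.* (W ℕ.+ W)
  P2≤ H f@(c₀ , c₁ , c₂) W τ≤W = begin
    P2 H f
      ≡⟨ P2≡∑ H f ⟩
    ∑[ a < n ] ∑[ b < n ] ∑[ c < n ] ∑[ d < n ] 𝟙 (charPoly (x a , x b , x c , x d) ≟P f)
      ≤⟨ ∑-mono-≤ n (λ a _ → ∑-mono-≤ n λ b _ → ∑-mono-≤ n λ c _ → d-determined a b c) ⟩
    ∑[ a < n ] productCount H (N a)
      ≤⟨ ∑-mono-≤ n (λ a _ → productCount≤ H (N a) W τ≤W) ⟩
    ∑[ a < n ] (isRoot a ℕ.* (n ℕ.+ n) ℕ.+ (W ℕ.+ W))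
      ≡⟨ ∑-distrib-+ n (λ a → isRoot a ℕ.* (n ℕ.+ n)) (λ _ → W ℕ.+ W) ⟩
    ∑[ a < n ] (isRoot a ℕ.* (n ℕ.+ n)) ℕ.+ ∑[ _ < n ] (W ℕ.+ W)
      ≡⟨ cong₂ ℕ._+_ (∑-distribʳ-* n (n ℕ.+ n) isRoot) (∑-const n (W ℕ.+ W)) ⟩
    ∑[ a < n ] isRoot a ℕ.* (n ℕ.+ n) ℕ.+ n ℕ.* (W ℕ.+ W)
      ≤⟨ ℕ.+-monoˡ-≤ (n ℕ.* (W ℕ.+ W)) (ℕ.*-monoˡ-≤ (n ℕ.+ n) (∑-box-quadratic≤2 H t c₀)) ⟩
    2 ℕ.* (n ℕ.+ n) ℕ.+ n ℕ.* (W ℕ.+ W)   ∎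
    where
    open ℕ.≤-Reasoning
    n = boxSize H
    x = entry H
    t = - c₁
    N : ℕ → ℤ
    N a = x a * (t - x a) - c₀
    isRoot : ℕ → ℕ
    isRoot a = 𝟙 (N a ℤ.≟ 0ℤ)
    d-determined : ∀ a b c → ∑[ d < n ] 𝟙 (charPoly (x a , x b , x c , x d) ≟P f) ℕ.≤ 𝟙 (x b * x c ℤ.≟ N a)
    d-determined a b c = begin
      ∑[ d < n ] 𝟙 (charPoly (x a , x b , x c , x d) ≟P f)
        ≤⟨ ∑-mono-≤ n (λ d _ → 𝟙-mono (charPoly (x a , x b , x c , x d) ≟P f) (d≡? d ×-dec bc≡?) (charPoly≡⇒ {x a} {x b} {x c} {x d})) ⟩
      ∑[ d < n ] 𝟙 (d≡? d ×-dec bc≡?)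
        ≡⟨ ∑-cong n (λ d _ → 𝟙-× (d≡? d) bc≡?) ⟩
      ∑[ d < n ] (𝟙 (d≡? d) ℕ.* 𝟙 bc≡?)
        ≡⟨ ∑-distribʳ-* n (𝟙 bc≡?) (𝟙 ∘ d≡?) ⟩
      ∑[ d < n ] 𝟙 (d≡? d) ℕ.* 𝟙 bc≡?
        ≤⟨ ℕ.*-monoˡ-≤ (𝟙 bc≡?) (∑-box-𝟙≡ H (t - x a)) ⟩
      1 ℕ.* 𝟙 bc≡?
        ≡⟨ ℕ.*-identityˡ (𝟙 bc≡?) ⟩
      𝟙 bc≡?     ∎
      where
      d≡? : ∀ d → Dec (x d ≡ t - x a)
      d≡? d = x d ℤ.≟ t - x a
      bc≡? : Dec (x b * x c ≡ N a)
      bc≡? = x b * x c ℤ.≟ N a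

open DivisorFunction using (τ; τ^Q≤[Q^Q]^[2^Q∸2]*n; ^-distribʳ-*)
open MatrixCount using (P2≤; boxSize)
open import Data.Nat
open import Data.Nat.Properties
open import Data.Nat.Tactic.RingSolver using (solve-∀)
open import Data.Product using (∃-syntax; _,_)
open import Data.Sum using (inj₁; inj₂)
open import Data.Empty using (⊥-elim)
open import Relation.Nullary using (yes; no)
open import Relation.Binary.PropositionalEquality

τ-max : ℕ → ℕ
τ-max zero    = 0
τ-max (suc L) = τ-max L ⊔ τ (suc L)

τ≤τ-max : ∀ L {M} .{{_ : NonZero M}} → M ≤ L → τ M ≤ τ-max L
τ≤τ-max zero    {M} M≤0 = ⊥-elim (≢-nonZero⁻¹ M (n≤0⇒n≡0 M≤0))
τ≤τ-max (suc L) {M} M≤1+L with m≤n⇒m<n∨m≡n M≤1+L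
... | inj₁ M<1+L = ≤-trans (τ≤τ-max L (s≤s⁻¹ M<1+L)) (m≤m⊔n (τ-max L) _)
... | inj₂ refl  = m≤n⊔m (τ-max L) _

τ-max^Q≤[Q^Q]^[2^Q∸2]*L : ∀ Q L .{{_ : NonZero Q}} → τ-max L ^ Q ≤ (Q ^ Q) ^ (2 ^ Q ∸ 2) * L
τ-max^Q≤[Q^Q]^[2^Q∸2]*L Q@(suc _) zero = z≤n
τ-max^Q≤[Q^Q]^[2^Q∸2]*L Q (suc L) with ⊔-sel (τ-max L) (τ (suc L))
... | inj₁ max≡τ-max rewrite max≡τ-max =
  ≤-trans (τ-max^Q≤[Q^Q]^[2^Q∸2]*L Q L) (*-monoʳ-≤ ((Q ^ Q) ^ (2 ^ Q ∸ 2)) (n≤1+n L))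
... | inj₂ max≡τ rewrite max≡τ = τ^Q≤[Q^Q]^[2^Q∸2]*n Q (suc L)

P2≤18*H*τ-max[H*H] : ∀ H f → 1 ≤ H → P2 H f ≤ 18 * H * τ-max (H * H)
P2≤18*H*τ-max[H*H] H f 1≤H = begin
  P2 H f                                     ≤⟨ P2≤ H f W (λ M → τ≤τ-max (H * H)) ⟩
  2 * (n + n) + n * (W + W)                  ≤⟨ +-mono-≤ (*-monoʳ-≤ 2 (+-mono-≤ n≤3H n≤3H)) (*-monoˡ-≤ (W + W) n≤3H) ⟩
  2 * (3 * H + 3 * H) + 3 * H * (W + W)      ≤⟨ +-monoˡ-≤ (3 * H * (W + W)) (m≤m*n (2 * (3 * H + 3 * H)) W {{W≢0}}) ⟩
  2 * (3 * H + 3 * H) * W + 3 * H * (W + W)  ≡⟨ collect H W ⟩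
  18 * H * W                                 ∎
  where
  open ≤-Reasoning
  W = τ-max (H * H)
  n = boxSize H
  W≢0 : NonZero W
  W≢0 = >-nonZero (τ≤τ-max (H * H) (*-mono-≤ 1≤H 1≤H))
  n≤3H : n ≤ 3 * H
  n≤3H = subst (n ≤_) (sym (3*H≡H+[H+H] H)) (+-monoˡ-≤ (H + H) 1≤H)
    where
    3*H≡H+[H+H] : ∀ H → 3 * H ≡ H + (H + H)
    3*H≡H+[H+H] = solve-∀
  collect : ∀ H W → 2 * (3 * H + 3 * H) * W + 3 * H * (W + W) ≡ 18 * H * W
  collect = solve-∀

C : ℕ → ℕ
C Q = 18 ^ Q * (Q ^ Q) ^ (2 ^ Q ∸ 2)

P2^Q≤C*H^[Q+2] : ∀ Q H f .{{_ : NonZero Q}} → 1 ≤ H → P2 H f ^ Q ≤ C Q * H ^ (Q + 2)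
P2^Q≤C*H^[Q+2] Q H f 1≤H = begin
  P2 H f ^ Q                       ≤⟨ ^-monoˡ-≤ Q (P2≤18*H*τ-max[H*H] H f 1≤H) ⟩
  (18 * H * W) ^ Q                 ≡⟨ trans (^-distribʳ-* (18 * H) W Q) (cong (_* W ^ Q) (^-distribʳ-* 18 H Q)) ⟩
  18 ^ Q * H ^ Q * W ^ Q           ≤⟨ *-monoʳ-≤ (18 ^ Q * H ^ Q) (τ-max^Q≤[Q^Q]^[2^Q∸2]*L Q (H * H)) ⟩
  18 ^ Q * H ^ Q * (K * (H * H))   ≡⟨ rearrange (18 ^ Q) (H ^ Q) K H ⟩
  18 ^ Q * K * (H ^ Q * H ^ 2)     ≡⟨ cong (18 ^ Q * K *_) (^-distribˡ-+-* H Q 2) ⟨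
  18 ^ Q * K * H ^ (Q + 2)         ∎
  where
  open ≤-Reasoning
  W = τ-max (H * H)
  K = (Q ^ Q) ^ (2 ^ Q ∸ 2)
  rearrange : ∀ a b k h → a * b * (k * (h * h)) ≡ a * k * (b * (h * (h * 1)))
  rearrange = solve-∀

^-cancelʳ-≤ : ∀ k .{{_ : NonZero k}} {m n} → m ^ k ≤ n ^ k → m ≤ n
^-cancelʳ-≤ k {m} {n} m^k≤n^k with m ≤? n
... | yes m≤n = m≤n
... | no  m≰n = ⊥-elim (<⇒≱ (^-monoˡ-< k (≰⇒> m≰n)) m^k≤n^k)

lemma2p1 : (p q : ℕ) → 0 < p → 0 < q →
    ∃[ H₀ ] ((H : ℕ) → H₀ ≤ H → 1 ≤ H → (f : Poly) → Deg2 f →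
    P2 H f ^ q ≤ H ^ (q + p))
lemma2p1 p q 0<p 0<q = C Q , bound
  where
  Q = q * 3
  instance
    _ : NonZero Q
    _ = m*n≢0 q 3 {{>-nonZero 0<q}}
  bound : (H : ℕ) → C Q ≤ H → 1 ≤ H → (f : Poly) → Deg2 f → P2 H f ^ q ≤ H ^ (q + p)
  bound H C≤H 1≤H f _ = ^-cancelʳ-≤ 3 (begin
    (P2 H f ^ q) ^ 3                           ≡⟨ ^-*-assoc (P2 H f) q 3 ⟩
    P2 H f ^ Q                                 ≤⟨ P2^Q≤C*H^[Q+2] Q H f 1≤H ⟩
    C Q * H ^ (Q + 2)                          ≤⟨ *-monoˡ-≤ (H ^ (Q + 2)) C≤H ⟩
    H * H ^ (Q + 2)                            ≡⟨ cong (H ^_) (+-comm 1 (Q + 2)) ⟩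
    H ^ (Q + 2 + 1)                            ≤⟨ ^-monoʳ-≤ H {{>-nonZero 1≤H}} Q+3≤[q+p]*3 ⟩
    H ^ ((q + p) * 3)                          ≡⟨ ^-*-assoc H (q + p) 3 ⟨
    (H ^ (q + p)) ^ 3                          ∎)
    where
    open ≤-Reasoning
    Q+3≤[q+p]*3 : Q + 2 + 1 ≤ (q + p) * 3
    Q+3≤[q+p]*3 = begin
      Q + 2 + 1      ≡⟨ +-assoc Q 2 1 ⟩
      Q + 3          ≤⟨ +-monoʳ-≤ Q (*-monoˡ-≤ 3 0<p) ⟩
      Q + p * 3      ≡⟨ *-distribʳ-+ 3 q p ⟨
      (q + p) * 3    ∎
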